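{- Let $m$ be a positive integer. Then $m \in \operatorname{Im}(P)$ (i.e. $m = P(M)$ for some $M \in \mathcal{M}$) if and only if $m$ admits a $t$-squared partition for some positive integer $t$, i.e. there exist a positive integer $t$ and positive integers $c_1,\ldots,c_t$ such that $$m = (c_1+\cdots+c_t)^2 + 2(c_1^2+\cdots+c_t^2).$$
   Context: Let $\mathcal{M}$ be the set of all two-line matrices $M=\begin{pmatrix} c_1 & c_2 & \cdots & c_s\\ d_1 & d_2 & \cdots & d_s\end{pmatrix}$ ($s\ge 1$) with non-negative integer entries satisfying $c_s=0$, $d_s\neq 0$, and $c_j=c_{j+1}+d_{j+1}$ for $j=1,\ldots,s-1$. Let $\ell(M)$ be the sum of all entries of $M$ and put $N=\ell(M)-d_1$. The Path Procedure associates to $M$ the collection of "hook" parts $$\lambda_{k,i} = 2\Big(N - (d_2+\cdots+d_k) - (c_1+\cdots+c_{k-1}) - i\Big) - 1,\qquad k=1,\ldots,s-1,\ i=0,\ldots,c_k-1$$ (empty sums are $0$), which form a partition into distinct odd parts greater than $1$. Define $P:\mathcal{M}\to\mathbb{Z}_{\ge 0}$ by $P(M)=\sum_{k,i}\lambda_{k,i}$ (so $P(M)=0$ when $s=1$). A positive integer $m$ admits a $t$-squared partition if $m=b^2+c_1^2+\cdots+c_t^2+c_1^2+\cdots+c_t^2$ with $b=c_1+\cdots+c_t$ and $c_1,\ldots,c_t$ positive integers. -}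

module Defs where

open import Data.Nat as ℕ using (ℕ; zero; suc; _<_)
open import Data.Integer as ℤ using (ℤ; +_)
open import Data.Product using (_×_; _,_; Σ; ∃)
open import Data.List using (List; []; _∷_; map; _++_; upTo)
import Data.List as L
open import Data.Vec using (Vec; lookup)
import Data.Vec as V
open import Data.Fin using (Fin)
open import Data.Empty using (⊥)
open import Relation.Binary.PropositionalEquality using (_≡_; _≢_)

-- A two-line matrix is the list of its columns (c_j , d_j), j = 1..s.
TwoLine : Set
TwoLine = List (ℕ × ℕ)

InM : TwoLine → Set
InM [] = ⊥
InM ((c , d) ∷ []) = (c ≡ 0) × (d ≢ 0)
InM ((c , d) ∷ (c' , d') ∷ rest) = (c ≡ c' ℕ.+ d') × InM ((c' , d') ∷ rest)

ℓ : TwoLine → ℕ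
ℓ M = L.foldr ℕ._+_ 0 (map (λ { (c , d) → c ℕ.+ d }) M)

-- N = ℓ(M) - d_1  (d_1 ≤ ℓ(M), so truncated subtraction is exact)
Nval : TwoLine → ℕ
Nval [] = 0
Nval M@((c , d) ∷ _) = ℓ M ℕ.∸ d

-- Hook parts, computed in ℤ (no truncation).
-- hooksFrom N D C cols : D = d_2+⋯+d_k, C = c_1+⋯+c_{k-1}, cols = columns k..s.
-- Produces λ_{k,i} = 2(N - D - C - i) - 1 for i < c_k, for k = 1..s-1.
hooksFrom : ℤ → ℤ → ℤ → TwoLine → List ℤ
hooksFrom N D C [] = []
hooksFrom N D C (_ ∷ []) = []
hooksFrom N D C ((c , d) ∷ (c' , d') ∷ rest) =
  map (λ i → (+ 2) ℤ.* (N ℤ.- D ℤ.- C ℤ.- (+ i)) ℤ.- (+ 1)) (upTo c)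
  ++ hooksFrom N (D ℤ.+ (+ d')) (C ℤ.+ (+ c)) ((c' , d') ∷ rest)

hooks : TwoLine → List ℤ
hooks M = hooksFrom (+ Nval M) (+ 0) (+ 0) M

P : TwoLine → ℤ
P M = L.foldr ℤ._+_ (+ 0) (hooks M)

TSquared : ℕ → ℕ → Set
TSquared t m = Σ (Vec ℕ t) λ cs →
  ((i : Fin t) → 0 < lookup cs i) ×
  (m ≡ (V.sum cs) ℕ.^ 2 ℕ.+ V.sum (V.map (λ c → c ℕ.^ 2) cs)
                        ℕ.+ V.sum (V.map (λ c → c ℕ.^ 2) cs))

module Submission where

-- The proof rests on a closed formula for P.  For M ∈ 𝓜 let firstRow M =
-- (c₁, …, c_{s-1}) be its first row without the final entry c_s = 0; then
--     P(M) = (Σ c_j)² + 2 Σ c_j²                                  (P-firstRow)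
-- The hooks λ_{k,0}, …, λ_{k,c_k-1} of column k are the c_k odd numbers just
-- below 2Y_k, where Y_k = N − (d₂+⋯+d_k) − (c₁+⋯+c_{k-1}); they sum to
-- 2c_kY_k − c_k² (hookBlock-sum).  Since N = c₁ + Σ c_j (Nval-firstRow) and
-- c_j = c_{j+1} + d_{j+1}, every level is Y_k = c_k + (c_k + ⋯ + c_{s-1})
-- (hooksFrom-sum), and adding up the columns gives the formula.
-- Forward direction: the entries of firstRow M are positive
-- (firstRow-positive), so they form a t-squared partition of P(M).
-- Backward direction: the value of a partition does not depend on the order
-- of its parts, so we sort them decreasingly; a decreasing list of positive
-- integers is the first row of the matrix in 𝓜 whose second row lists the
-- consecutive differences (columns).

open import Defs
open import Data.Nat using (ℕ; _<_)
open import Data.Integer using (+_)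
open import Data.Product using (_×_; Σ)
open import Function.Bundles using (_⇔_)
open import Relation.Binary.PropositionalEquality using (_≡_)

open import Data.Nat using (_+_; _*_; _∸_; _^_; _≥_; z<s)
open import Data.Nat.Properties as ℕ using (≤-decTotalOrder)
open import Data.Nat.ListAction using (sum)
open import Data.Nat.ListAction.Properties using (sum-↭)
import Data.Nat.Tactic.RingSolver as ℕ-Solver
open import Data.Integer as ℤ using (ℤ)
import Data.Integer.Properties as ℤ
import Data.Integer.Tactic.RingSolver as ℤ-Solver
open import Data.Product using (_,_)
open import Data.List using (List; []; _∷_; [_]; _++_; map; foldr; upTo; length)
open import Data.List.Properties using (upTo-∷ʳ; map-++)
open import Data.List.Relation.Unary.All using (All; []; _∷_)
open import Data.List.Relation.Unary.Linked using (Linked; [-]; _∷_)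
open import Data.List.Relation.Binary.Permutation.Propositional using (_↭_; ↭-sym)
open import Data.List.Relation.Binary.Permutation.Propositional.Properties using (map⁺; All-resp-↭)
import Data.List.Sort as Sort
import Relation.Binary.Construct.Flip.EqAndOrd as Flip
open import Data.Vec as V using (Vec)
open import Data.Vec.Properties using (toList-map; toList∘fromList)
open import Data.Vec.Relation.Unary.All.Properties using (lookup⁺; lookup⁻; toList⁺; fromList⁺)
open import Relation.Nullary using (contradiction)
open import Relation.Binary.PropositionalEquality using (refl; sym; trans; cong; cong₂; module ≡-Reasoning)
open import Function.Bundles using (mk⇔)

open ≡-Reasoning

sumSq : List ℕ → ℕ
sumSq cs = sum (map (_^ 2) cs)

partitionValue : List ℕ → ℕ
partitionValue cs = sum cs ^ 2 + sumSq cs + sumSq cs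

partitionValue-∷ : ∀ c cs →
  partitionValue (c ∷ cs) ≡ (c * c + 2 * c * (c + sum cs)) + partitionValue cs
partitionValue-∷ c cs = identity c (sum cs) (sumSq cs)
  where
  -- stated with x ^ 2 unfolded to its definition x * (x * 1)
  identity : ∀ c s q → (c + s) * ((c + s) * 1) + (c * (c * 1) + q) + (c * (c * 1) + q)
                     ≡ (c * c + 2 * c * (c + s)) + (s * (s * 1) + q + q)
  identity = ℕ-Solver.solve-∀

partitionValue-↭ : ∀ {xs ys} → xs ↭ ys → partitionValue xs ≡ partitionValue ys
partitionValue-↭ p = cong₂ (λ s q → s ^ 2 + q + q) (sum-↭ p) (sum-↭ (map⁺ (_^ 2) p))

sum-toList : ∀ {t} (cs : Vec ℕ t) → V.sum cs ≡ sum (V.toList cs)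
sum-toList V.[] = refl
sum-toList (c V.∷ cs) = cong (_+_ c) (sum-toList cs)

partitionValue-toList : ∀ {t} (cs : Vec ℕ t) →
  V.sum cs ^ 2 + V.sum (V.map (λ c → c ^ 2) cs) + V.sum (V.map (λ c → c ^ 2) cs)
    ≡ partitionValue (V.toList cs)
partitionValue-toList cs =
  cong₂ (λ s q → s ^ 2 + q + q) (sum-toList cs)
        (trans (sum-toList (V.map (_^ 2) cs)) (cong sum (toList-map (_^ 2) cs)))

sumℤ : List ℤ → ℤ
sumℤ = foldr ℤ._+_ (+ 0)

sumℤ-++ : ∀ xs ys → sumℤ (xs ++ ys) ≡ sumℤ xs ℤ.+ sumℤ ys
sumℤ-++ [] ys = sym (ℤ.+-identityˡ _)
sumℤ-++ (x ∷ xs) ys = trans (cong (ℤ._+_ x) (sumℤ-++ xs ys)) (sym (ℤ.+-assoc x _ _))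

hook : ℤ → ℕ → ℤ
hook Y i = + 2 ℤ.* (Y ℤ.- + i) ℤ.- + 1

hookBlock-sum : ∀ n Y → sumℤ (map (hook Y) (upTo n)) ≡ + n ℤ.* (+ 2 ℤ.* Y) ℤ.- + n ℤ.* + n
hookBlock-sum ℕ.zero Y = base Y
  where
  base : ∀ Y → + 0 ≡ + 0 ℤ.* (+ 2 ℤ.* Y) ℤ.- + 0 ℤ.* + 0
  base = ℤ-Solver.solve-∀
hookBlock-sum (ℕ.suc n) Y = begin
  sumℤ (map (hook Y) (upTo (ℕ.suc n)))
    ≡⟨ cong (λ is → sumℤ (map (hook Y) is)) (sym (upTo-∷ʳ n)) ⟩
  sumℤ (map (hook Y) (upTo n ++ [ n ]))
    ≡⟨ cong sumℤ (map-++ (hook Y) (upTo n) [ n ]) ⟩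
  sumℤ (map (hook Y) (upTo n) ++ [ hook Y n ])
    ≡⟨ sumℤ-++ (map (hook Y) (upTo n)) _ ⟩
  sumℤ (map (hook Y) (upTo n)) ℤ.+ (hook Y n ℤ.+ + 0)
    ≡⟨ cong (ℤ._+ (hook Y n ℤ.+ + 0)) (hookBlock-sum n Y) ⟩
  (+ n ℤ.* (+ 2 ℤ.* Y) ℤ.- + n ℤ.* + n) ℤ.+ (hook Y n ℤ.+ + 0)
    ≡⟨ step (+ n) Y ⟩
  (+ 1 ℤ.+ + n) ℤ.* (+ 2 ℤ.* Y) ℤ.- (+ 1 ℤ.+ + n) ℤ.* (+ 1 ℤ.+ + n)
    ≡⟨ cong (λ k → k ℤ.* (+ 2 ℤ.* Y) ℤ.- k ℤ.* k) (ℤ.pos-+ 1 n) ⟨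
  + ℕ.suc n ℤ.* (+ 2 ℤ.* Y) ℤ.- + ℕ.suc n ℤ.* + ℕ.suc n ∎
  where
  step : ∀ n Y → (n ℤ.* (+ 2 ℤ.* Y) ℤ.- n ℤ.* n) ℤ.+ ((+ 2 ℤ.* (Y ℤ.- n) ℤ.- + 1) ℤ.+ + 0)
                 ≡ (+ 1 ℤ.+ n) ℤ.* (+ 2 ℤ.* Y) ℤ.- (+ 1 ℤ.+ n) ℤ.* (+ 1 ℤ.+ n)
  step = ℤ-Solver.solve-∀

hookBlock-above : ∀ n k → sumℤ (map (hook (+ (n + k))) (upTo n)) ≡ + (n * n + 2 * n * k)
hookBlock-above n k = begin
  sumℤ (map (hook (+ (n + k))) (upTo n))
    ≡⟨ hookBlock-sum n (+ (n + k)) ⟩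
  + n ℤ.* (+ 2 ℤ.* + (n + k)) ℤ.- + n ℤ.* + n
    ≡⟨ cong (λ y → + n ℤ.* (+ 2 ℤ.* y) ℤ.- + n ℤ.* + n) (ℤ.pos-+ n k) ⟩
  + n ℤ.* (+ 2 ℤ.* (+ n ℤ.+ + k)) ℤ.- + n ℤ.* + n
    ≡⟨ expand (+ n) (+ k) ⟩
  + n ℤ.* + n ℤ.+ + 2 ℤ.* + n ℤ.* + k
    ≡⟨ cong₂ ℤ._+_ (ℤ.pos-* n n) (trans (ℤ.pos-* (2 * n) k) (cong (ℤ._* + k) (ℤ.pos-* 2 n))) ⟨
  + (n * n) ℤ.+ + (2 * n * k)
    ≡⟨ ℤ.pos-+ (n * n) (2 * n * k) ⟨
  + (n * n + 2 * n * k) ∎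
  where
  expand : ∀ n k → n ℤ.* (+ 2 ℤ.* (n ℤ.+ k)) ℤ.- n ℤ.* n ≡ n ℤ.* n ℤ.+ + 2 ℤ.* n ℤ.* k
  expand = ℤ-Solver.solve-∀

-- The first row of a matrix without its last entry (which is c_s = 0 on 𝓜).
firstRow : TwoLine → List ℕ
firstRow [] = []
firstRow (_ ∷ []) = []
firstRow ((c , _) ∷ col ∷ cols) = c ∷ firstRow (col ∷ cols)

-- Column invariant: if the level of the current column (c , d) is
-- Y = c + Σ firstRow, the remaining hooks sum to the partition value of the
-- remaining first row.  Passing to the next column lowers the level by
-- d' + c = (c − c') + c, which restores the invariant since c = c' + d'.
hooksFrom-sum : ∀ {c d} cols (N D C : ℤ) → InM ((c , d) ∷ cols) →
  N ℤ.- D ℤ.- C ≡ + (c + sum (firstRow ((c , d) ∷ cols))) →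
  sumℤ (hooksFrom N D C ((c , d) ∷ cols)) ≡ + partitionValue (firstRow ((c , d) ∷ cols))
hooksFrom-sum [] N D C _ _ = refl
hooksFrom-sum {c} ((c' , d') ∷ cols) N D C (refl , inM) level = begin
  sumℤ (map (hook Y) (upTo c) ++ hooksFrom N D' C' tail)
    ≡⟨ sumℤ-++ (map (hook Y) (upTo c)) _ ⟩
  sumℤ (map (hook Y) (upTo c)) ℤ.+ sumℤ (hooksFrom N D' C' tail)
    ≡⟨ cong₂ ℤ._+_ block (hooksFrom-sum cols N D' C' inM level′) ⟩
  + (c * c + 2 * c * (c + S)) ℤ.+ + partitionValue (firstRow tail)
    ≡⟨ ℤ.pos-+ (c * c + 2 * c * (c + S)) (partitionValue (firstRow tail)) ⟨
  + (c * c + 2 * c * (c + S) + partitionValue (firstRow tail))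
    ≡⟨ cong +_ (partitionValue-∷ c (firstRow tail)) ⟨
  + partitionValue (c ∷ firstRow tail) ∎
  where
  tail : TwoLine
  tail = (c' , d') ∷ cols
  S : ℕ
  S = sum (firstRow tail)
  Y D' C' : ℤ
  Y = N ℤ.- D ℤ.- C
  D' = D ℤ.+ + d'
  C' = C ℤ.+ + c
  block : sumℤ (map (hook Y) (upTo c)) ≡ + (c * c + 2 * c * (c + S))
  block = trans (cong (λ y → sumℤ (map (hook y) (upTo c))) level) (hookBlock-above c (c + S))
  split : + (c + (c + S)) ≡ + d' ℤ.+ + c ℤ.+ + (c' + S)
  split = begin
    + (c + (c + S))             ≡⟨ cong +_ (regroup c' d' S) ⟩
    + (d' + c + (c' + S))       ≡⟨ ℤ.pos-+ (d' + c) (c' + S) ⟩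
    + (d' + c) ℤ.+ + (c' + S)   ≡⟨ cong (ℤ._+ + (c' + S)) (ℤ.pos-+ d' c) ⟩
    + d' ℤ.+ + c ℤ.+ + (c' + S) ∎
    where
    regroup : ∀ c' d' S → c' + d' + (c' + d' + S) ≡ d' + (c' + d') + (c' + S)
    regroup = ℕ-Solver.solve-∀
  level′ : N ℤ.- D' ℤ.- C' ≡ + (c' + S)
  level′ = begin
    N ℤ.- D' ℤ.- C'
      ≡⟨ lower N D C (+ d') (+ c) ⟩
    Y ℤ.- + d' ℤ.- + c
      ≡⟨ cong (λ y → y ℤ.- + d' ℤ.- + c) (trans level split) ⟩
    + d' ℤ.+ + c ℤ.+ + (c' + S) ℤ.- + d' ℤ.- + c
      ≡⟨ cancel (+ d') (+ c) (+ (c' + S)) ⟩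
    + (c' + S) ∎
    where
    lower : ∀ N D C d c → N ℤ.- (D ℤ.+ d) ℤ.- (C ℤ.+ c) ≡ N ℤ.- D ℤ.- C ℤ.- d ℤ.- c
    lower = ℤ-Solver.solve-∀
    cancel : ∀ d c x → d ℤ.+ c ℤ.+ x ℤ.- d ℤ.- c ≡ x
    cancel = ℤ-Solver.solve-∀

-- ℓ(M) = c₁ + Σ firstRow M + d₁ on 𝓜, since each d_{j+1} = c_j − c_{j+1}
-- telescopes against the first row.
ℓ-firstRow : ∀ {c d} cols → InM ((c , d) ∷ cols) →
  ℓ ((c , d) ∷ cols) ≡ c + sum (firstRow ((c , d) ∷ cols)) + d
ℓ-firstRow {d = d} [] (refl , _) = ℕ.+-identityʳ d
ℓ-firstRow {d = d} ((c' , d') ∷ cols) (refl , inM) =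
  trans (cong (_+_ (c' + d' + d)) (ℓ-firstRow cols inM))
        (regroup c' d' d (sum (firstRow ((c' , d') ∷ cols))))
  where
  regroup : ∀ c' d' d S → c' + d' + d + (c' + S + d') ≡ c' + d' + (c' + d' + S) + d
  regroup = ℕ-Solver.solve-∀

Nval-firstRow : ∀ {c d} cols → InM ((c , d) ∷ cols) →
  Nval ((c , d) ∷ cols) ≡ c + sum (firstRow ((c , d) ∷ cols))
Nval-firstRow {d = d} cols inM =
  trans (cong (_∸ d) (ℓ-firstRow cols inM)) (ℕ.m+n∸n≡m _ d)

P-firstRow : ∀ M → InM M → P M ≡ + partitionValue (firstRow M)
P-firstRow ((c , d) ∷ cols) inM = hooksFrom-sum cols (+ N) (+ 0) (+ 0) inM level
  where
  N : ℕ
  N = Nval ((c , d) ∷ cols)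
  level : + N ℤ.- + 0 ℤ.- + 0 ≡ + (c + sum (firstRow ((c , d) ∷ cols)))
  level = trans (dropZeros (+ N)) (cong +_ (Nval-firstRow cols inM))
    where
    dropZeros : ∀ x → x ℤ.- + 0 ℤ.- + 0 ≡ x
    dropZeros = ℤ-Solver.solve-∀

-- On 𝓜 the first row decreases weakly down to c_{s-1} = d_s > 0, so all its
-- entries are positive.
firstRow-positive : ∀ M → InM M → All (0 <_) (firstRow M)
firstRow-positive (_ ∷ []) _ = []
firstRow-positive (_ ∷ (_ , d') ∷ []) (refl , refl , d'≢0) = ℕ.n≢0⇒n>0 d'≢0 ∷ []
firstRow-positive (_ ∷ (c' , d') ∷ col ∷ cols) (refl , inM)
  with firstRow-positive ((c' , d') ∷ col ∷ cols) inM
... | positive@(c'>0 ∷ _) = ℕ.<-≤-trans c'>0 (ℕ.m≤m+n c' d') ∷ positive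

-- The entry following the head of a first row, with c_s = 0 past its end.
nextEntry : List ℕ → ℕ
nextEntry [] = 0
nextEntry (c ∷ _) = c

columns : ℕ → List ℕ → TwoLine
columns d [] = (0 , d) ∷ []
columns d (c ∷ cs) = (c , d) ∷ columns (c ∸ nextEntry cs) cs

columns-inM : ∀ d {c cs} → Linked _≥_ (c ∷ cs) → All (0 <_) (c ∷ cs) → InM (columns d (c ∷ cs))
columns-inM d [-] (c>0 ∷ []) = refl , refl , ℕ.>⇒≢ c>0
columns-inM d (c≥c' ∷ decreasing) (_ ∷ positive) =
  sym (ℕ.m+[n∸m]≡n c≥c') , columns-inM _ decreasing positive

firstRow-columns : ∀ d cs → firstRow (columns d cs) ≡ cs
firstRow-columns d [] = refl
firstRow-columns d (c ∷ []) = refl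
firstRow-columns d (c ∷ c' ∷ cs) = cong (c ∷_) (firstRow-columns (c ∸ c') (c' ∷ cs))

open Sort (Flip.decTotalOrder ≤-decTotalOrder) using (sort; sort-↭; sort-↗)

tsquared-of-parts : ∀ {m} cs → 0 < m → All (0 <_) cs → m ≡ partitionValue cs →
  Σ ℕ (λ t → (0 < t) × TSquared t m)
tsquared-of-parts [] 0<m _ refl = contradiction 0<m (ℕ.n≮n 0)
tsquared-of-parts cs@(_ ∷ _) _ positive m≡ =
  length cs , z<s , V.fromList cs , lookup⁺ (fromList⁺ positive) , trans m≡ (sym value)
  where
  value : V.sum (V.fromList cs) ^ 2 + V.sum (V.map (λ c → c ^ 2) (V.fromList cs))
            + V.sum (V.map (λ c → c ^ 2) (V.fromList cs)) ≡ partitionValue cs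
  value = trans (partitionValue-toList (V.fromList cs)) (cong partitionValue (toList∘fromList cs))

P-of-parts : ∀ {m} cs → 0 < m → Linked _≥_ cs → All (0 <_) cs → m ≡ partitionValue cs →
  Σ TwoLine (λ M → InM M × (+ m ≡ P M))
P-of-parts [] 0<m _ _ refl = contradiction 0<m (ℕ.n≮n 0)
P-of-parts {m} cs@(_ ∷ _) _ decreasing positive m≡ = columns 0 cs , inM , (begin
  + m                                        ≡⟨ cong +_ m≡ ⟩
  + partitionValue cs                        ≡⟨ cong (λ r → + partitionValue r) (firstRow-columns 0 cs) ⟨
  + partitionValue (firstRow (columns 0 cs)) ≡⟨ P-firstRow (columns 0 cs) inM ⟨
  P (columns 0 cs)                           ∎)
  where
  inM : InM (columns 0 cs)
  inM = columns-inM 0 decreasing positive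

theorem3p2 : (m : ℕ) → 0 < m →
    (Σ TwoLine (λ M → InM M × (+ m ≡ P M))) ⇔ (Σ ℕ (λ t → (0 < t) × TSquared t m))
theorem3p2 m 0<m = mk⇔ toPartition fromPartition
  where
  toPartition : Σ TwoLine (λ M → InM M × (+ m ≡ P M)) → Σ ℕ (λ t → (0 < t) × TSquared t m)
  toPartition (M , inM , m≡P) =
    tsquared-of-parts (firstRow M) 0<m (firstRow-positive M inM)
      (ℤ.+-injective (trans m≡P (P-firstRow M inM)))

  fromPartition : Σ ℕ (λ t → (0 < t) × TSquared t m) → Σ TwoLine (λ M → InM M × (+ m ≡ P M))
  fromPartition (_ , _ , cs , positive , m≡) =
    P-of-parts (sort parts) 0<m (sort-↗ parts)
      (All-resp-↭ (↭-sym (sort-↭ parts)) (toList⁺ (lookup⁻ positive)))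
      (trans m≡ (trans (partitionValue-toList cs) (sym (partitionValue-↭ (sort-↭ parts)))))
    where
    parts : List ℕ
    parts = V.toList cs
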